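{- Let $G$ and $H$ be connected graphs, each with at least two vertices. Then $G\square H$ has a matching-cut if and only if $G$ has a matching-cut or $H$ has a matching-cut.
   Context: All graphs are finite, simple and undirected. For a connected graph $X$ and a pair $(V_1,V_2)$ of nonempty disjoint sets with union $V(X)$, the cut is the set of edges with one endpoint in $V_1$ and the other in $V_2$; a matching-cut is such a cut in which no two edges share a vertex. The cartesian product $G\square H$ has vertex set $V(G)\times V(H)$, with $(g_1,h_1)$ adjacent to $(g_2,h_2)$ iff either $g_1=g_2$ and $h_1h_2\in E(H)$, or $h_1=h_2$ and $g_1g_2\in E(G)$. -}

module Defs where

open import Level using (0ℓ)
open import Data.Bool using (Bool; true; false)
open import Data.Nat using (ℕ; suc; _≤_)
open import Data.List using (List; []; _∷_; cartesianProduct; length)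
open import Data.List.Membership.Propositional using (_∈_)
open import Data.Product using (_×_; _,_; Σ; ∃; ∃-syntax; proj₁; proj₂)
open import Data.Sum using (_⊎_)
open import Relation.Nullary using (¬_; Dec; yes; no)
open import Data.Product.Properties using (≡-dec)
open import Data.List.Membership.Propositional.Properties using (∈-cartesianProduct⁺)
open import Relation.Binary.PropositionalEquality using (_≡_; _≢_; refl)

record Graph : Set₁ where
  field
    V        : Set
    _≟V_     : (u v : V) → Dec (u ≡ v)
    vertices : List V
    complete : (v : V) → v ∈ vertices
    Adj      : V → V → Set
    Adj?     : (u v : V) → Dec (Adj u v)
    sym      : ∀ {u v} → Adj u v → Adj v u
    irrefl   : ∀ {v} → ¬ Adj v v

open Graph public

data Walk (G : Graph) : V G → V G → Set where
  here : ∀ {v} → Walk G v v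
  step : ∀ {u w v} → Adj G u w → Walk G w v → Walk G u v

Connected : Graph → Set
Connected G = (u v : V G) → Walk G u v

AtLeastTwoVertices : Graph → Set
AtLeastTwoVertices G = Σ (V G) λ u → Σ (V G) λ v → u ≢ v

-- A pair (V₁, V₂) of disjoint sets with union V(G) is encoded by a
-- side-function  s : V G → Bool  (V₁ = s⁻¹(true), V₂ = s⁻¹(false));
-- both must be nonempty. An edge uv is in the cut iff s u ≢ s v.
-- The cut is a matching (no two cut edges share a vertex) iff no vertex
-- is incident with two distinct cut edges.
IsMatchingCut : (G : Graph) → (V G → Bool) → Set
IsMatchingCut G s =
  (∃[ v ] s v ≡ true) × (∃[ v ] s v ≡ false) ×
  (∀ {u v w} → Adj G u v → s u ≢ s v → Adj G u w → s u ≢ s w → v ≡ w)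

HasMatchingCut : Graph → Set
HasMatchingCut G = ∃[ s ] IsMatchingCut G s

data ProdAdj (G H : Graph) : V G × V H → V G × V H → Set where
  inH : ∀ {g h₁ h₂} → Adj H h₁ h₂ → ProdAdj G H (g , h₁) (g , h₂)
  inG : ∀ {g₁ g₂ h} → Adj G g₁ g₂ → ProdAdj G H (g₁ , h) (g₂ , h)

private
  prodAdj? : (G H : Graph) → (p q : V G × V H) → Dec (ProdAdj G H p q)
  prodAdj? G H (g₁ , h₁) (g₂ , h₂) with _≟V_ G g₁ g₂ | _≟V_ H h₁ h₂
  ... | yes refl | _ with Adj? H h₁ h₂
  ...   | yes a = yes (inH a)
  ...   | no ¬a = no λ { (inH a) → ¬a a ; (inG a) → irrefl G a }
  prodAdj? G H (g₁ , h₁) (g₂ , h₂) | no g≢ | yes refl with Adj? G g₁ g₂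
  ...   | yes a = yes (inG a)
  ...   | no ¬a = no λ { (inH a) → g≢ refl ; (inG a) → ¬a a }
  prodAdj? G H (g₁ , h₁) (g₂ , h₂) | no g≢ | no h≢ =
    no λ { (inH a) → g≢ refl ; (inG a) → h≢ refl }

  prodSym : (G H : Graph) → ∀ {p q} → ProdAdj G H p q → ProdAdj G H q p
  prodSym G H (inH a) = inH (sym H a)
  prodSym G H (inG a) = inG (sym G a)

  prodIrrefl : (G H : Graph) → ∀ {p} → ¬ ProdAdj G H p p
  prodIrrefl G H (inH a) = irrefl H a
  prodIrrefl G H (inG a) = irrefl G a

_□_ : Graph → Graph → Graph
G □ H = record
  { V        = V G × V H
  ; _≟V_     = ≡-dec (_≟V_ G) (_≟V_ H)
  ; vertices = cartesianProduct (vertices G) (vertices H)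
  ; complete = λ { (g , h) → ∈-cartesianProduct⁺ (complete G g) (complete H h) }
  ; Adj      = ProdAdj G H
  ; Adj?     = prodAdj? G H
  ; sym      = prodSym G H
  ; irrefl   = prodIrrefl G H
  }

-- A matching-cut of G □ H restricts to every G-layer and every H-layer. If some G-layer
-- is split by it, that layer is a matching-cut of G; otherwise every G-layer lies on one
-- side, so the two sides of the cut differ along some H-layer, which is then a
-- matching-cut of H. Conversely, a matching-cut of G, extended constantly along the
-- H-coordinate, cuts only G-edges of G □ H, and these still form a matching; the case of
-- H follows by the symmetry G □ H ≅ H □ G.
module Submission where

open import Defs
open import Data.Bool using (Bool; true; false)
open import Data.Empty using (⊥-elim)
open import Data.Product using (_×_; _,_; proj₁; proj₂; swap)
open import Data.Sum using (_⊎_; inj₁; inj₂)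
open import Function using (_∘_)
open import Function.Definitions using (Injective)
open import Relation.Binary.PropositionalEquality using (_≡_; _≢_; refl; cong)

CutIsMatching : (G : Graph) → (V G → Bool) → Set
CutIsMatching G s =
  ∀ {u v w} → Adj G u v → s u ≢ s v → Adj G u w → s u ≢ s w → v ≡ w

record Embedding (G K : Graph) : Set where
  field
    map       : V G → V K
    injective : Injective _≡_ _≡_ map
    adj       : ∀ {u v} → Adj G u v → Adj K (map u) (map v)

open Embedding

isMatchingCut-pullback : ∀ {G K} (e : Embedding G K) {s : V K → Bool} {a b : V G} →
  CutIsMatching K s → s (map e a) ≡ true → s (map e b) ≡ false →
  IsMatchingCut G (s ∘ map e)
isMatchingCut-pullback e m sa sb =
  (_ , sa) , (_ , sb) ,
  λ uv ne uw ne′ → injective e (m (adj e uv) ne (adj e uw) ne′)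

module _ (G H : Graph) where

  layerG : V H → Embedding G (G □ H)
  layerG h = record { map = _, h ; injective = cong proj₁ ; adj = inG }

  layerH : V G → Embedding H (G □ H)
  layerH g = record { map = g ,_ ; injective = cong proj₂ ; adj = inH }

  □-swap : Embedding (G □ H) (H □ G)
  □-swap = record { map = swap ; injective = cong swap ; adj = swapAdj }
    where
    swapAdj : ∀ {p q} → ProdAdj G H p q → ProdAdj H G (swap p) (swap q)
    swapAdj (inH a) = inG a
    swapAdj (inG a) = inH a

  hasMatchingCut-□⁻ : HasMatchingCut (G □ H) → HasMatchingCut G ⊎ HasMatchingCut H
  hasMatchingCut-□⁻ (s , ((g₁ , h₁) , s₁) , ((g₂ , h₂) , s₂) , m) with s (g₂ , h₁) in s₃
  ... | false = inj₁ (_ , isMatchingCut-pullback (layerG h₁) m s₁ s₃)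
  ... | true  = inj₂ (_ , isMatchingCut-pullback (layerH g₂) m s₃ s₂)

  isMatchingCut-□ˡ : V H → {s : V G → Bool} →
    IsMatchingCut G s → IsMatchingCut (G □ H) (s ∘ proj₁)
  isMatchingCut-□ˡ h {s} ((g₁ , s₁) , (g₂ , s₂) , m) =
    ((g₁ , h) , s₁) , ((g₂ , h) , s₂) , matching
    where
    -- Only G-edges can cross the cut, and two of them at a common vertex share its H-coordinate.
    matching : CutIsMatching (G □ H) (s ∘ proj₁)
    matching (inH _) ne _        _   = ⊥-elim (ne refl)
    matching (inG _) _  (inH _)  ne′ = ⊥-elim (ne′ refl)
    matching (inG a) ne (inG b)  ne′ with m a ne b ne′
    ... | refl = refl

hasMatchingCut-swap : ∀ G H → HasMatchingCut (H □ G) → HasMatchingCut (G □ H)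
hasMatchingCut-swap G H (_ , (p , sp) , (q , sq) , m) =
  _ , isMatchingCut-pullback (□-swap G H) {a = swap p} {b = swap q} m sp sq

lemma3 : (G H : Graph) →
    Connected G → AtLeastTwoVertices G →
    Connected H → AtLeastTwoVertices H →
    (HasMatchingCut (G □ H) → HasMatchingCut G ⊎ HasMatchingCut H) ×
    (HasMatchingCut G ⊎ HasMatchingCut H → HasMatchingCut (G □ H))
lemma3 G H _ (g , _) _ (h , _) = hasMatchingCut-□⁻ G H , hasMatchingCut-□⁺
  where
  hasMatchingCut-□⁺ : HasMatchingCut G ⊎ HasMatchingCut H → HasMatchingCut (G □ H)
  hasMatchingCut-□⁺ (inj₁ (_ , c)) = _ , isMatchingCut-□ˡ G H h c
  hasMatchingCut-□⁺ (inj₂ (_ , c)) = hasMatchingCut-swap G H (_ , isMatchingCut-□ˡ H G g c)
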